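{- Let $(G,f,\pi)$ be an SDS with $\pi=\pi_1\pi_2\cdots\pi_n$, let $1\le k\le n$, and let $\pi_{\tau^k}=\pi_{k+1}\cdots\pi_n\pi_1\pi_2\cdots\pi_k$. Then the map $h=F_{\pi_k}\circ F_{\pi_{k-1}}\circ\cdots\circ F_{\pi_1}$ is a homomorphism from the phase space of $(G,f,\pi)$ to the phase space of $(G,f,\pi_{\tau^k})$, i.e. $F_\pi(X)=Y$ implies $F_{\pi_{\tau^k}}(h(X))=h(Y)$. Furthermore, restricted to the limit cycles, $h$ induces an isomorphism: $h$ maps the union of the limit cycles of $(G,f,\pi)$ bijectively onto the union of the limit cycles of $(G,f,\pi_{\tau^k})$, carrying each limit cycle onto a limit cycle of the same length.
   Context: Let $G$ be a simple graph with vertex set $\{1,\dots,n\}$, each vertex having a state in $\mathbb{F}_2=\{0,1\}$; states are elements of $\mathbb{F}_2^n$. Each vertex $i$ has a local function $f_i$ of the states of $i$ and its neighbours; its inflation $F_i:\mathbb{F}_2^n\to\mathbb{F}_2^n$ replaces coordinate $i$ by this value and fixes other coordinates. For an update schedule (permutation) $\sigma=\sigma_1\cdots\sigma_n$, $F_\sigma=F_{\sigma_n}\circ\cdots\circ F_{\sigma_1}$; $(G,f,\sigma)$ is an SDS. Its phase space is the directed graph on $\mathbb{F}_2^n$ with edges $X\to F_\sigma(X)$; limit cycles are the directed cycles of the phase space. -}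

module Defs where

open import Data.Nat using (ℕ; zero; suc; _≤_; _<_)
open import Data.Fin using (Fin)
open import Data.Bool using (Bool)
open import Data.Vec using (Vec; lookup; _[_]≔_)
open import Data.List using (List; []; _∷_; map; take; drop; _++_; allFin)
open import Data.Fin.Permutation using (Permutation′; _⟨$⟩ʳ_)
open import Data.Sum using (_⊎_)
open import Data.Product using (_×_; ∃)
open import Data.Empty using (⊥)
open import Relation.Binary.PropositionalEquality using (_≡_; _≢_)

-- A simple graph on the vertex set Fin n (vertex i : Fin n stands for i+1).
record Graph (n : ℕ) : Set₁ where
  field
    Adj    : Fin n → Fin n → Set
    symAdj : ∀ {i j} → Adj i j → Adj j i
    irrAdj : ∀ {i} → Adj i i → ⊥

State : ℕ → Set
State n = Vec Bool n

record LocalFunctions {n : ℕ} (G : Graph n) : Set where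
  open Graph G
  field
    fun   : Fin n → State n → Bool
    local : ∀ i (X Y : State n) →
            (∀ j → (j ≡ i ⊎ Adj i j) → lookup X j ≡ lookup Y j) →
            fun i X ≡ fun i Y

module _ {n : ℕ} {G : Graph n} (f : LocalFunctions G) where
  open LocalFunctions f

  inflate : Fin n → State n → State n
  inflate i X = X [ i ]≔ fun i X

  applyWord : List (Fin n) → State n → State n
  applyWord []       X = X
  applyWord (v ∷ vs) X = applyWord vs (inflate v X)

word : ∀ {n} → Permutation′ n → List (Fin n)
word {n} π = map (π ⟨$⟩ʳ_) (allFin n)

shiftWord : ∀ {n} → ℕ → Permutation′ n → List (Fin n)
shiftWord k π = drop k (word π) ++ take k (word π)

iter : ∀ {A : Set} → ℕ → (A → A) → A → A
iter zero    F x = x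
iter (suc m) F x = F (iter m F x)

OnLimitCycle : ∀ {A : Set} → (A → A) → A → Set
OnLimitCycle F X = ∃ λ m → 1 ≤ m × iter m F X ≡ X

CycleLength : ∀ {A : Set} → (A → A) → A → ℕ → Set
CycleLength F X m = 1 ≤ m × iter m F X ≡ X × (∀ j → 1 ≤ j → j < m → iter j F X ≢ X)

-- Write Fπ = g ∘ h with g = F_{π_n} ∘ ⋯ ∘ F_{π_{k+1}}; then Fτ = h ∘ g, so h conjugates Fπ-orbits
-- into Fτ-orbits and g conjugates back.  On a cycle of period p, Fπ^p = g ∘ Fτ^(p-1) ∘ h is the
-- identity, so h is injective there; and h maps g(Fτ^(p-1) Z) to Fτ^p Z = Z, so it is onto.
module Submission where

open import Defs
open import Data.Nat using (ℕ; _≤_; zero; suc; _+_; _*_)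
open import Data.Nat.Properties using (+-comm; *-comm)
open import Data.List using ([]; _∷_; take; drop; _++_)
open import Data.List.Properties using (take++drop≡id)
open import Data.Product using (_×_; ∃; _,_)
open import Data.Fin.Permutation using (Permutation′)
open import Function using (_∘_)
open import Relation.Binary.PropositionalEquality
  using (_≡_; _≗_; refl; sym; trans; cong; module ≡-Reasoning)

module _ {A : Set} {F : A → A} where

  iter-suc-inner : ∀ m X → iter (suc m) F X ≡ iter m F (F X)
  iter-suc-inner zero    X = refl
  iter-suc-inner (suc m) X = cong F (iter-suc-inner m X)

  iter-+ : ∀ a b X → iter a F (iter b F X) ≡ iter (a + b) F X
  iter-+ zero    b X = refl
  iter-+ (suc a) b X = cong F (iter-+ a b X)

  iter-comm : ∀ a b X → iter a F (iter b F X) ≡ iter b F (iter a F X)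
  iter-comm a b X = begin
    iter a F (iter b F X)  ≡⟨ iter-+ a b X ⟩
    iter (a + b) F X       ≡⟨ cong (λ t → iter t F X) (+-comm a b) ⟩
    iter (b + a) F X       ≡⟨ sym (iter-+ b a X) ⟩
    iter b F (iter a F X)  ∎
    where open ≡-Reasoning

  iter-*-periodic : ∀ j m X → iter m F X ≡ X → iter (j * m) F X ≡ X
  iter-*-periodic zero    m X e = refl
  iter-*-periodic (suc j) m X e = begin
    iter (m + j * m) F X         ≡⟨ sym (iter-+ m (j * m) X) ⟩
    iter m F (iter (j * m) F X)  ≡⟨ cong (iter m F) (iter-*-periodic j m X e) ⟩
    iter m F X                   ≡⟨ e ⟩
    X                            ∎
    where open ≡-Reasoning

  OnLimitCycle-iter : ∀ j X → OnLimitCycle F X → OnLimitCycle F (iter j F X)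
  OnLimitCycle-iter j X (m , 1≤m , e) = m , 1≤m , trans (iter-comm m j X) (cong (iter j F) e)

module Semiconjugacy {A : Set} (F F′ g h : A → A) (F≗g∘h : F ≗ g ∘ h) (F′≗h∘g : F′ ≗ h ∘ g) where

  iter-h : ∀ m X → iter m F′ (h X) ≡ h (iter m F X)
  iter-h zero    X = refl
  iter-h (suc m) X = begin
    F′ (iter m F′ (h X))   ≡⟨ cong F′ (iter-h m X) ⟩
    F′ (h (iter m F X))    ≡⟨ F′≗h∘g _ ⟩
    h (g (h (iter m F X))) ≡⟨ cong h (sym (F≗g∘h _)) ⟩
    h (F (iter m F X))     ∎
    where open ≡-Reasoning

  iter-g : ∀ m Y → iter m F (g Y) ≡ g (iter m F′ Y)
  iter-g zero    Y = refl
  iter-g (suc m) Y = begin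
    F (iter m F (g Y))      ≡⟨ cong F (iter-g m Y) ⟩
    F (g (iter m F′ Y))     ≡⟨ F≗g∘h _ ⟩
    g (h (g (iter m F′ Y))) ≡⟨ cong g (sym (F′≗h∘g _)) ⟩
    g (F′ (iter m F′ Y))    ∎
    where open ≡-Reasoning

  iter-suc-through-h : ∀ m X → iter (suc m) F X ≡ g (iter m F′ (h X))
  iter-suc-through-h m X = begin
    iter (suc m) F X     ≡⟨ iter-suc-inner m X ⟩
    iter m F (F X)       ≡⟨ cong (iter m F) (F≗g∘h X) ⟩
    iter m F (g (h X))   ≡⟨ iter-g m (h X) ⟩
    g (iter m F′ (h X))  ∎
    where open ≡-Reasoning

  h-step : ∀ X Y → F X ≡ Y → F′ (h X) ≡ h Y
  h-step X Y FX≡Y = trans (F′≗h∘g (h X)) (cong h (trans (sym (F≗g∘h X)) FX≡Y))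

  h-OnLimitCycle : ∀ X → OnLimitCycle F X → OnLimitCycle F′ (h X)
  h-OnLimitCycle X (m , 1≤m , e) = m , 1≤m , trans (iter-h m X) (cong h e)

  h-injective-on-cycles : ∀ X Y → OnLimitCycle F X → OnLimitCycle F Y → h X ≡ h Y → X ≡ Y
  h-injective-on-cycles X Y (suc a , _ , eX) (suc b , _ , eY) hX≡hY = begin
    X                    ≡⟨ sym period-X ⟩
    iter (suc q) F X     ≡⟨ iter-suc-through-h q X ⟩
    g (iter q F′ (h X))  ≡⟨ cong (g ∘ iter q F′) hX≡hY ⟩
    g (iter q F′ (h Y))  ≡⟨ sym (iter-suc-through-h q Y) ⟩
    iter (suc q) F Y     ≡⟨ period-Y ⟩
    Y                    ∎
    where
    open ≡-Reasoning
    q : ℕ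
    q = b + a * suc b
    period-Y : iter (suc q) F Y ≡ Y
    period-Y = iter-*-periodic {F = F} (suc a) (suc b) Y eY
    period-X : iter (suc q) F X ≡ X
    period-X = trans (cong (λ t → iter t F X) (*-comm (suc a) (suc b)))
                     (iter-*-periodic {F = F} (suc b) (suc a) X eX)

  h-onto-cycles : ∀ Z → OnLimitCycle F′ Z → ∃ λ X → OnLimitCycle F X × h X ≡ Z
  h-onto-cycles Z (suc a , 1≤m , eZ) = X , (suc a , 1≤m , period-X) , hX≡Z
    where
    X : A
    X = g (iter a F′ Z)
    hX≡Z : h X ≡ Z
    hX≡Z = trans (sym (F′≗h∘g _)) eZ
    period-X : iter (suc a) F X ≡ X
    period-X = trans (iter-g (suc a) _)
                     (cong g (trans (iter-comm (suc a) a Z) (cong (iter a F′) eZ)))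

  h-CycleLength : ∀ X m → CycleLength F X m → CycleLength F′ (h X) m
  h-CycleLength X m (1≤m , eX , minimal) =
    1≤m , trans (iter-h m X) (cong h eX) ,
    λ j 1≤j j<m hX-returns → minimal j 1≤j j<m
      (h-injective-on-cycles _ _ (OnLimitCycle-iter j X cycle) cycle
        (trans (sym (iter-h j X)) hX-returns))
    where
    cycle : OnLimitCycle F X
    cycle = m , 1≤m , eX

module _ {n} {G : Graph n} (f : LocalFunctions G) where

  applyWord-++ : ∀ xs ys X → applyWord f (xs ++ ys) X ≡ applyWord f ys (applyWord f xs X)
  applyWord-++ []       ys X = refl
  applyWord-++ (x ∷ xs) ys X = applyWord-++ xs ys _

  applyWord-take-drop : ∀ k w X →
    applyWord f w X ≡ applyWord f (drop k w) (applyWord f (take k w) X)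
  applyWord-take-drop k w X =
    trans (cong (λ l → applyWord f l X) (sym (take++drop≡id k w)))
          (applyWord-++ (take k w) (drop k w) X)

proposition3p6 : ∀ {n} (G : Graph n) (f : LocalFunctions G) (π : Permutation′ n) (k : ℕ) →
    1 ≤ k → k ≤ n →
    let Fπ = applyWord f (word π)
        Fτ = applyWord f (shiftWord k π)
        h  = applyWord f (take k (word π))
    in
    -- homomorphism of phase spaces
    (∀ X Y → Fπ X ≡ Y → Fτ (h X) ≡ h Y)
    -- h maps limit cycles into limit cycles
    × (∀ X → OnLimitCycle Fπ X → OnLimitCycle Fτ (h X))
    -- injective on the union of limit cycles
    × (∀ X Y → OnLimitCycle Fπ X → OnLimitCycle Fπ Y → h X ≡ h Y → X ≡ Y)
    -- onto the union of limit cycles of the shifted SDS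
    × (∀ Z → OnLimitCycle Fτ Z → ∃ λ X → OnLimitCycle Fπ X × h X ≡ Z)
    -- each limit cycle goes to a limit cycle of the same length
    × (∀ X m → CycleLength Fπ X m → CycleLength Fτ (h X) m)
proposition3p6 G f π k _ _ =
  h-step , h-OnLimitCycle , h-injective-on-cycles , h-onto-cycles , h-CycleLength
  where
  open Semiconjugacy (applyWord f (word π)) (applyWord f (shiftWord k π))
                     (applyWord f (drop k (word π))) (applyWord f (take k (word π)))
                     (applyWord-take-drop f k (word π))
                     (applyWord-++ f (drop k (word π)) (take k (word π)))
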